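{- For integers $n,k\ge1$, \[f_{\mathrm{UFR}}(n,k)=k\,f_{\mathrm{UFR}}(n-1,k-1)+(2k-n+1)\,f_{\mathrm{UFR}}(n-1,k),\] where $f_{\mathrm{UFR}}(m,j)$ denotes the number of unit Fubini rankings with $m$ competitors having exactly $j$ lucky cars.
   Context: A Fubini ranking with $m$ competitors is a tuple $\alpha=(a_1,\ldots,a_m)\in\{1,\ldots,m\}^m$ with $a_i=1+|\{j:a_j<a_i\}|$ for every $i$. A unit Fubini ranking is a Fubini ranking in which each value appears at most twice. For $m=0$ there is exactly one (empty) unit Fubini ranking, with $0$ lucky cars, so $f_{\mathrm{UFR}}(0,0)=1$ and $f_{\mathrm{UFR}}(0,j)=0$ for $j\neq0$. Lucky cars: cars $1,\ldots,m$ enter in order a one-way street with spots $1,\ldots,m$; car $i$ parks at spot $a_i$ if free, else at the first free spot after $a_i$; car $i$ is lucky if it parks at spot $a_i$. -}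

module Defs where

open import Data.Nat using (ℕ; zero; suc; _+_; _<ᵇ_; _≡ᵇ_; _≤ᵇ_)
open import Data.Bool using (Bool; true; false; _∧_; if_then_else_; not)
open import Data.List using (List; []; _∷_; map; filter; length; concatMap; upTo)
open import Data.Bool.ListAction using (all; any)
open import Data.Vec using (Vec; []; _∷_; toList)
open import Relation.Binary.PropositionalEquality using (_≡_)
open import Data.Bool using (T?)

countB : (ℕ → Bool) → List ℕ → ℕ
countB p [] = 0
countB p (x ∷ xs) = if p x then suc (countB p xs) else countB p xs

allVecs : List ℕ → (len : ℕ) → List (Vec ℕ len)
allVecs vals zero = [] ∷ []
allVecs vals (suc len) = concatMap (λ x → map (x ∷_) (allVecs vals len)) vals

candidates : (m : ℕ) → List (Vec ℕ m)
candidates m = allVecs (map suc (upTo m)) m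

isFubiniB : ∀ {m} → Vec ℕ m → Bool
isFubiniB v = all (λ a → a ≡ᵇ suc (countB (λ b → b <ᵇ a) (toList v))) (toList v)

isUnitB : ∀ {m} → Vec ℕ m → Bool
isUnitB v = all (λ a → countB (λ b → b ≡ᵇ a) (toList v) ≤ᵇ 2) (toList v)

-- Unit Fubini ranking test (the tuple is assumed to lie in {1,…,m}^m).
isUFRB : ∀ {m} → Vec ℕ m → Bool
isUFRB v = isFubiniB v ∧ isUnitB v

_∈ᵇ_ : ℕ → List ℕ → Bool
x ∈ᵇ xs = any (λ y → y ≡ᵇ x) xs

-- Parking rule: first free spot ≥ a among the occupied list `occ`
-- (fuel bounds the search; fuel = number of spots suffices).
firstFree : (fuel : ℕ) → ℕ → List ℕ → ℕ
firstFree zero a occ = a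
firstFree (suc fuel) a occ = if a ∈ᵇ occ then firstFree fuel (suc a) occ else a

-- Cars enter in order; returns number of lucky cars (car parks at its preference).
-- m = number of spots, occ = occupied spots so far.
luckyAux : ℕ → List ℕ → List ℕ → ℕ
luckyAux m occ [] = 0
luckyAux m occ (a ∷ as) =
  let s = firstFree m a occ in
  (if s ≡ᵇ a then 1 else 0) + luckyAux m (s ∷ occ) as

luckyCars : ∀ {m} → Vec ℕ m → ℕ
luckyCars {m} v = luckyAux m [] (toList v)

fUFR : ℕ → ℕ → ℕ
fUFR m j = length (filter (λ v → T? (isUFRB v ∧ (luckyCars v ≡ᵇ j))) (candidates m))

-- Car i is lucky exactly when a_i has not occurred before: a repeated preference a finds spot a
-- taken and parks at a + 1, which is free because a Fubini ranking with a tie at a never uses the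
-- value a + 1.  So f_UFR(n, k) counts unit Fubini rankings of length n with k distinct values.
-- Classify them by their first entry x.  If x does not recur, deleting it and closing the gap at x
-- gives a ranking u of length n - 1 with k - 1 values; conversely x may be any value of u or n,
-- which makes k choices.  If x recurs, deleting its first copy and closing the gap at x + 1 gives a
-- ranking u with k values in which x occurs once; as u has n - 1 entries and every value occurs once
-- or twice, there are 2k - (n - 1) such x.
module Submission where

open import Defs
open import Algebra.Bundles using (CommutativeMonoid)
import Algebra.Properties.CommutativeSemigroup as CommutativeSemigroupProperties
open import Data.Bool using (Bool; true; false; T; not; _∧_; _∨_; if_then_else_)
open import Data.Bool.ListAction using (all)
open import Data.Bool.Properties using (T-≡; T-∧; T-∨; ∨-commutativeMonoid; ∨-identityʳ; ∨-zeroʳ)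
open import Data.Empty using (⊥-elim)
open import Data.List using (List; []; _∷_; _++_; [_]; map; filter; length; concatMap; upTo)
open import Data.List.Properties using (++-identityʳ; map-++; upTo-∷ʳ)
open import Data.List.Relation.Unary.All as All using (All; []; _∷_)
open import Data.List.Relation.Unary.All.Properties using (all⁺; all⁻; map⁺; map⁻; applyUpTo⁺₁)
open import Data.Nat using (ℕ; zero; suc; _+_; _*_; _∸_; _≤_; _<_; _≡ᵇ_; _<ᵇ_; _≤ᵇ_)
open import Data.Nat using (z≤n; s≤s; s≤s⁻¹; z<s; s<s; s<s⁻¹)
open import Data.Nat.Induction using (<-wellFounded)
open import Data.Nat.Properties
open import Data.Product using (∃-syntax; _×_; _,_; proj₂; map₁; map₂)
open import Data.Sum as Sum using (_⊎_; inj₁; inj₂; [_,_]′)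
open import Data.Vec using (Vec; []; _∷_; toList)
import Data.Vec as Vec
open import Data.Vec.Properties using (toList-map; length-toList)
open import Function using (id; _∘_; _⇔_; mk⇔; Equivalence)
open import Induction.WellFounded using (Acc; acc)
open import Relation.Binary.Core using (_Preserves_⟶_)
open import Relation.Binary.Definitions using (tri<; tri≈; tri>)
open import Relation.Binary.PropositionalEquality hiding ([_])
open import Relation.Nullary using (¬_; yes; no; contradiction)
open import Relation.Nullary.Decidable using (dec-true; dec-false; T?)

open CommutativeSemigroupProperties +-commutativeSemigroup
  using (interchange) renaming (x∙yz≈y∙xz to +-left-comm)
open CommutativeSemigroupProperties *-commutativeSemigroup
  using () renaming (xy∙z≈xz∙y to *-right-comm)
open CommutativeSemigroupProperties (CommutativeMonoid.commutativeSemigroup ∨-commutativeMonoid)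
  using () renaming (x∙yz≈y∙xz to ∨-left-comm)

toℕ : Bool → ℕ
toℕ false = 0
toℕ true  = 1

toℕ-∧ : ∀ a b → toℕ (a ∧ b) ≡ toℕ a * toℕ b
toℕ-∧ false b = refl
toℕ-∧ true  b = sym (+-identityʳ (toℕ b))

toℕ-∨ : ∀ b c → toℕ (b ∨ c) ≡ toℕ c + toℕ b * toℕ (not c)
toℕ-∨ false c     = sym (+-identityʳ (toℕ c))
toℕ-∨ true  true  = refl
toℕ-∨ true  false = refl

toℕ-cong : ∀ {a b} → T a ⇔ T b → toℕ a ≡ toℕ b
toℕ-cong {false} {false} _   = refl
toℕ-cong {false} {true}  a⇔b = ⊥-elim (Equivalence.from a⇔b _)
toℕ-cong {true}  {false} a⇔b = ⊥-elim (Equivalence.to a⇔b _)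
toℕ-cong {true}  {true}  _   = refl

¬T⇒≡false : ∀ {b} → ¬ T b → b ≡ false
¬T⇒≡false {false} _  = refl
¬T⇒≡false {true}  ¬t = ⊥-elim (¬t _)

≡ᵇ-true : ∀ {m n} → m ≡ n → (m ≡ᵇ n) ≡ true
≡ᵇ-true {m} {n} = dec-true (m ≟ n)

≡ᵇ-false : ∀ {m n} → m ≢ n → (m ≡ᵇ n) ≡ false
≡ᵇ-false {m} {n} = dec-false (m ≟ n)

<ᵇ-true : ∀ {m n} → m < n → (m <ᵇ n) ≡ true
<ᵇ-true {m} {n} = dec-true (m <? n)

<ᵇ-false : ∀ {m n} → n ≤ m → (m <ᵇ n) ≡ false
<ᵇ-false {m} {n} n≤m = dec-false (m <? n) (≤⇒≯ n≤m)

∑ : {A : Set} → List A → (A → ℕ) → ℕ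
∑ []       f = 0
∑ (x ∷ xs) f = f x + ∑ xs f

syntax ∑ xs (λ x → e) = ∑[ x ∈ xs ] e

module _ {A : Set} where

  ∑-cong : ∀ {f g : A → ℕ} → (∀ x → f x ≡ g x) → ∀ xs → ∑ xs f ≡ ∑ xs g
  ∑-cong f≡g []       = refl
  ∑-cong f≡g (x ∷ xs) = cong₂ _+_ (f≡g x) (∑-cong f≡g xs)

  ∑-cong-All : ∀ {P : A → Set} {f g : A → ℕ} {xs} →
               (∀ {x} → P x → f x ≡ g x) → All P xs → ∑ xs f ≡ ∑ xs g
  ∑-cong-All f≡g []         = refl
  ∑-cong-All f≡g (px ∷ pxs) = cong₂ _+_ (f≡g px) (∑-cong-All f≡g pxs)

  ∑-zero : ∀ (xs : List A) → ∑[ x ∈ xs ] 0 ≡ 0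
  ∑-zero []       = refl
  ∑-zero (x ∷ xs) = ∑-zero xs

  ∑-+ : ∀ (f g : A → ℕ) xs → ∑[ x ∈ xs ] (f x + g x) ≡ ∑ xs f + ∑ xs g
  ∑-+ f g []       = refl
  ∑-+ f g (x ∷ xs) = begin
    f x + g x + ∑[ y ∈ xs ] (f y + g y) ≡⟨ cong (f x + g x +_) (∑-+ f g xs) ⟩
    f x + g x + (∑ xs f + ∑ xs g)       ≡⟨ interchange (f x) (g x) (∑ xs f) (∑ xs g) ⟩
    f x + ∑ xs f + (g x + ∑ xs g)       ∎
    where open ≡-Reasoning

  ∑-*ˡ : ∀ c (f : A → ℕ) xs → ∑[ x ∈ xs ] (c * f x) ≡ c * ∑ xs f
  ∑-*ˡ c f []       = sym (*-zeroʳ c)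
  ∑-*ˡ c f (x ∷ xs) =
    trans (cong (c * f x +_) (∑-*ˡ c f xs)) (sym (*-distribˡ-+ c (f x) (∑ xs f)))

  ∑-++ : ∀ (f : A → ℕ) xs ys → ∑ (xs ++ ys) f ≡ ∑ xs f + ∑ ys f
  ∑-++ f []       ys = refl
  ∑-++ f (x ∷ xs) ys =
    trans (cong (f x +_) (∑-++ f xs ys)) (sym (+-assoc (f x) (∑ xs f) (∑ ys f)))

  length-filter-T : ∀ (p : A → Bool) xs → length (filter (λ x → T? (p x)) xs) ≡ ∑ xs (toℕ ∘ p)
  length-filter-T p []       = refl
  length-filter-T p (x ∷ xs) with p x
  ... | true  = cong suc (length-filter-T p xs)
  ... | false = length-filter-T p xs

module _ {A B : Set} where

  ∑-comm : ∀ (f : A → B → ℕ) xs ys →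
           ∑[ x ∈ xs ] ∑[ y ∈ ys ] f x y ≡ ∑[ y ∈ ys ] ∑[ x ∈ xs ] f x y
  ∑-comm f []       ys = sym (∑-zero ys)
  ∑-comm f (x ∷ xs) ys = trans (cong (∑ ys (f x) +_) (∑-comm f xs ys))
                               (sym (∑-+ (f x) (λ y → ∑[ x′ ∈ xs ] f x′ y) ys))

  ∑-map : ∀ (f : B → ℕ) (g : A → B) xs → ∑ (map g xs) f ≡ ∑ xs (f ∘ g)
  ∑-map f g []       = refl
  ∑-map f g (x ∷ xs) = cong (f (g x) +_) (∑-map f g xs)

  ∑-concatMap : ∀ (f : B → ℕ) (g : A → List B) xs →
                ∑ (concatMap g xs) f ≡ ∑[ x ∈ xs ] ∑ (g x) f
  ∑-concatMap f g []       = refl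
  ∑-concatMap f g (x ∷ xs) = trans (∑-++ f (g x) (concatMap g xs))
                                   (cong (∑ (g x) f +_) (∑-concatMap f g xs))

∈ᵇ-here : ∀ x l → T (x ∈ᵇ (x ∷ l))
∈ᵇ-here x l = Equivalence.from T-∨ (inj₁ (≡⇒≡ᵇ x x refl))

∈ᵇ-there : ∀ a l {x} → T (x ∈ᵇ l) → T (x ∈ᵇ (a ∷ l))
∈ᵇ-there a l x∈l = Equivalence.from T-∨ (inj₂ x∈l)

∈ᵇ-++-∷ : ∀ x xs a ys → x ∈ᵇ (xs ++ a ∷ ys) ≡ (a ≡ᵇ x) ∨ (x ∈ᵇ (xs ++ ys))
∈ᵇ-++-∷ x []       a ys = refl
∈ᵇ-++-∷ x (c ∷ xs) a ys =
  trans (cong ((c ≡ᵇ x) ∨_) (∈ᵇ-++-∷ x xs a ys)) (∨-left-comm (c ≡ᵇ x) (a ≡ᵇ x) _)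

All-∈ᵇ : ∀ {P : ℕ → Set} {x l} → All P l → T (x ∈ᵇ l) → P x
All-∈ᵇ {P} {x} {a ∷ l} (pa ∷ pl) x∈ with Equivalence.to T-∨ x∈
... | inj₁ a≡x = subst P (≡ᵇ⇒≡ a x a≡x) pa
... | inj₂ x∈l = All-∈ᵇ pl x∈l

module _ (p : ℕ → Bool) where

  countB-∷ : ∀ a l → countB p (a ∷ l) ≡ toℕ (p a) + countB p l
  countB-∷ a l with p a
  ... | true  = refl
  ... | false = refl

  countB-∑ : ∀ l → countB p l ≡ ∑ l (toℕ ∘ p)
  countB-∑ []      = refl
  countB-∑ (x ∷ l) = trans (countB-∷ x l) (cong (toℕ (p x) +_) (countB-∑ l))

  countB-≤-length : ∀ l → countB p l ≤ length l
  countB-≤-length []      = z≤n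
  countB-≤-length (x ∷ l) with p x
  ... | true  = s≤s (countB-≤-length l)
  ... | false = m≤n⇒m≤1+n (countB-≤-length l)

  countB-all : ∀ {l} → All (T ∘ p) l → countB p l ≡ length l
  countB-all {[]}    []         = refl
  countB-all {x ∷ l} (px ∷ pxs) with p x
  ... | true = cong suc (countB-all pxs)

  countB-map : ∀ (g : ℕ → ℕ) l → countB p (map g l) ≡ countB (p ∘ g) l
  countB-map g []      = refl
  countB-map g (x ∷ l) with p (g x)
  ... | true  = cong suc (countB-map g l)
  ... | false = countB-map g l

  countB-short : ∀ l → countB p l < length l → ∃[ c ] T (c ∈ᵇ l) × ¬ T (p c)
  countB-short (x ∷ l) short with p x in px
  ... | false = x , ∈ᵇ-here x l , subst T px
  ... | true with countB-short l (≤-pred short)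
  ...   | c , c∈l , ¬pc = c , ∈ᵇ-there x l c∈l , ¬pc

countB-cong : ∀ {p q : ℕ → Bool} → (∀ c → p c ≡ q c) → ∀ l → countB p l ≡ countB q l
countB-cong {p} {q} p≡q l =
  trans (countB-∑ p l) (trans (∑-cong (cong toℕ ∘ p≡q) l) (sym (countB-∑ q l)))

count : ℕ → List ℕ → ℕ
count a = countB (_≡ᵇ a)

below : ℕ → List ℕ → ℕ
below a = countB (_<ᵇ a)

count-here : ∀ a l → count a (a ∷ l) ≡ suc (count a l)
count-here a l rewrite ≡ᵇ-true {a} refl = refl

count-mono-∷ : ∀ b a l → count b l ≤ count b (a ∷ l)
count-mono-∷ b a l = subst (count b l ≤_) (sym (countB-∷ _ a l)) (m≤n+m _ _)

∈ᵇ-count : ∀ x l → x ∈ᵇ l ≡ (0 <ᵇ count x l)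
∈ᵇ-count x []      = refl
∈ᵇ-count x (a ∷ l) with a ≡ᵇ x
... | true  = refl
... | false = ∈ᵇ-count x l

count-pos⇒∈ᵇ : ∀ {x} l → 0 < count x l → T (x ∈ᵇ l)
count-pos⇒∈ᵇ {x} l pos = subst T (sym (∈ᵇ-count x l)) (<⇒<ᵇ pos)

∈ᵇ⇒count-pos : ∀ {x} l → T (x ∈ᵇ l) → 0 < count x l
∈ᵇ⇒count-pos {x} l x∈l = <ᵇ⇒< 0 (count x l) (subst T (∈ᵇ-count x l) x∈l)

∉ᵇ⇒count≡0 : ∀ {x} l → ¬ T (x ∈ᵇ l) → count x l ≡ 0
∉ᵇ⇒count≡0 l x∉l = n≤0⇒n≡0 (≮⇒≥ (x∉l ∘ count-pos⇒∈ᵇ l))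

below-suc : ∀ b l → below (suc b) l ≡ below b l + count b l
below-suc b l = begin
  below (suc b) l                                   ≡⟨ countB-∑ _ l ⟩
  ∑[ c ∈ l ] toℕ (c <ᵇ suc b)                       ≡⟨ ∑-cong split l ⟩
  ∑[ c ∈ l ] (toℕ (c <ᵇ b) + toℕ (c ≡ᵇ b))          ≡⟨ ∑-+ _ _ l ⟩
  ∑[ c ∈ l ] toℕ (c <ᵇ b) + ∑[ c ∈ l ] toℕ (c ≡ᵇ b)
    ≡⟨ sym (cong₂ _+_ (countB-∑ _ l) (countB-∑ _ l)) ⟩
  below b l + count b l                             ∎
  where
  open ≡-Reasoning
  split : ∀ c → toℕ (c <ᵇ suc b) ≡ toℕ (c <ᵇ b) + toℕ (c ≡ᵇ b)
  split c with <-cmp c b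
  ... | tri< c<b _ _  rewrite <ᵇ-true (m≤n⇒m≤1+n c<b) | <ᵇ-true c<b | ≡ᵇ-false (<⇒≢ c<b) = refl
  ... | tri≈ _ refl _ rewrite <ᵇ-true (n<1+n c) | <ᵇ-false (≤-refl {c}) | ≡ᵇ-true {c} refl = refl
  ... | tri> _ _ c>b  rewrite <ᵇ-false c>b | <ᵇ-false (<⇒≤ c>b) | ≡ᵇ-false (>⇒≢ c>b) = refl

below+count≤length : ∀ a l → below a l + count a l ≤ length l
below+count≤length a l = subst (_≤ length l) (below-suc a l) (countB-≤-length _ l)

distinct : List ℕ → ℕ
distinct []      = 0
distinct (a ∷ l) = toℕ (not (a ∈ᵇ l)) + distinct l

distinct-move : ∀ xs a ys → distinct (xs ++ a ∷ ys) ≡ distinct (a ∷ xs ++ ys)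
distinct-move []       a ys = refl
distinct-move (b ∷ xs) a ys rewrite distinct-move xs a ys | ∈ᵇ-++-∷ b xs a ys with a ≟ b
... | yes refl rewrite ≡ᵇ-true {a} refl = refl
... | no a≢b   rewrite ≡ᵇ-false a≢b | ≡ᵇ-false (a≢b ∘ sym) =
  +-left-comm (toℕ (not (b ∈ᵇ (xs ++ ys)))) (toℕ (not (a ∈ᵇ (xs ++ ys)))) (distinct (xs ++ ys))

IsFubini : List ℕ → Set
IsFubini l = All (λ a → a ≡ suc (below a l)) l

IsUnit : List ℕ → Set
IsUnit l = All (λ a → count a l ≤ 2) l

IsUFR : List ℕ → Set
IsUFR l = IsFubini l × IsUnit l

-- isUFRB v is definitionally ufr (toList v).
ufr : List ℕ → Bool
ufr l = all (λ a → a ≡ᵇ suc (below a l)) l ∧ all (λ a → count a l ≤ᵇ 2) l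

T-ufr : ∀ l → T (ufr l) ⇔ IsUFR l
T-ufr l = mk⇔ to from
  where
  to : T (ufr l) → IsUFR l
  to t with Equivalence.to T-∧ t
  ... | fub , unit = All.map (≡ᵇ⇒≡ _ _) (all⁺ _ l fub) , All.map (≤ᵇ⇒≤ _ 2) (all⁺ _ l unit)
  from : IsUFR l → T (ufr l)
  from (fub , unit) =
    Equivalence.from T-∧ (all⁻ _ (All.map (≡⇒≡ᵇ _ _) fub) , all⁻ _ (All.map ≤⇒≤ᵇ unit))

isUnit⇒count≤2 : ∀ {l} → IsUnit l → ∀ a → count a l ≤ 2
isUnit⇒count≤2 {l} unit a with T? (a ∈ᵇ l)
... | yes a∈l = All-∈ᵇ unit a∈l
... | no  a∉l = subst (_≤ 2) (sym (∉ᵇ⇒count≡0 l a∉l)) z≤n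

fubini-gap : ∀ {l b} → IsFubini l → 2 ≤ count b l → count (suc b) l ≡ 0
fubini-gap {l} {b} fub 2≤cb = n≤0⇒n≡0 (≮⇒≥ λ pos → <-irrefl refl (b<b pos))
  where
  b<b : 0 < count (suc b) l → b < b
  b<b pos = begin-strict
    b                     ≡⟨ All-∈ᵇ fub (count-pos⇒∈ᵇ l (<-≤-trans z<s 2≤cb)) ⟩
    suc (below b l)       ≡⟨ +-comm 1 (below b l) ⟩
    below b l + 1         <⟨ +-monoʳ-< (below b l) 2≤cb ⟩
    below b l + count b l ≡⟨ sym (below-suc b l) ⟩
    below (suc b) l       ≡⟨ suc-injective (sym (All-∈ᵇ fub (count-pos⇒∈ᵇ l pos))) ⟩
    b                     ∎
    where open ≤-Reasoning

fubini-value+count : ∀ {l a} → IsFubini l → T (a ∈ᵇ l) → a + count a l ≤ suc (length l)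
fubini-value+count {l} {a} fub a∈l = begin
  a + count a l               ≡⟨ cong (_+ count a l) (All-∈ᵇ fub a∈l) ⟩
  suc (below a l + count a l) ≤⟨ s≤s (below+count≤length a l) ⟩
  suc (length l)              ∎
  where open ≤-Reasoning

fubini-tied<length : ∀ {l a} → IsFubini l → 2 ≤ count a l → a < length l
fubini-tied<length {l} {a} fub tied = s≤s⁻¹ (begin
  suc (suc a)    ≡⟨ +-comm 2 a ⟩
  a + 2          ≤⟨ +-monoʳ-≤ a tied ⟩
  a + count a l  ≤⟨ fubini-value+count fub (count-pos⇒∈ᵇ l (≤-trans (s≤s z≤n) tied)) ⟩
  suc (length l) ∎)
  where open ≤-Reasoning

fubini-tied-successor : ∀ {l a} → IsFubini (a ∷ l) → T (a ∈ᵇ l) → ¬ T (suc a ∈ᵇ l)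
fubini-tied-successor {l} {a} fub a∈l sa∈l = contradiction
  (subst (1 ≤_) (fubini-gap fub tied) (≤-trans (∈ᵇ⇒count-pos l sa∈l) (count-mono-∷ (suc a) a l)))
  λ ()
  where
  tied : 2 ≤ count a (a ∷ l)
  tied = subst (2 ≤_) (sym (count-here a l)) (s≤s (∈ᵇ⇒count-pos l a∈l))

below-witness : ∀ {x y} u → x ≤ y → below x u < below y u → ∃[ c ] T (c ∈ᵇ u) × x ≤ c × c < y
below-witness {x} {y} (a ∷ u) x≤y lt with a <? y | a <? x
... | no a≮y | _
  rewrite <ᵇ-false {a} {y} (≮⇒≥ a≮y) | <ᵇ-false {a} {x} (≤-trans x≤y (≮⇒≥ a≮y))
  = map₂ (map₁ (∈ᵇ-there a u)) (below-witness u x≤y lt)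
... | yes a<y | no a≮x = a , ∈ᵇ-here a u , ≮⇒≥ a≮x , a<y
... | yes a<y | yes a<x rewrite <ᵇ-true a<y | <ᵇ-true a<x
  = map₂ (map₁ (∈ᵇ-there a u)) (below-witness u x≤y (s<s⁻¹ lt))

-- Descend through entries y ≥ x: if y > x then the ranks force below x u < below y u, so some
-- entry lies in [x, y).
fubini-attained : ∀ {u x} → IsFubini u → x ≡ suc (below x u) → below x u < length u → T (x ∈ᵇ u)
fubini-attained {u} {x} fub x-rank short with countB-short _ u short
... | y , y∈u , y≮x = descend y (<-wellFounded y) y∈u (≮⇒≥ (y≮x ∘ <⇒<ᵇ))
  where
  descend : ∀ y → Acc _<_ y → T (y ∈ᵇ u) → x ≤ y → T (x ∈ᵇ u)
  descend y (acc rs) y∈u x≤y with m≤n⇒m<n∨m≡n x≤y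
  ... | inj₂ refl = y∈u
  ... | inj₁ x<y with below-witness u x≤y (s<s⁻¹ (subst₂ _<_ x-rank (All-∈ᵇ fub y∈u) x<y))
  ...   | c , c∈u , x≤c , c<y = descend c (rs c<y) c∈u x≤c

ufrWithDistinct : ℕ → List ℕ → ℕ
ufrWithDistinct j l = toℕ (ufr l) * toℕ (distinct l ≡ᵇ j)

module _ (j : ℕ) (l : List ℕ) where

  ufrWithDistinct-distinct : ∀ (f : ℕ → ℕ) →
                             ufrWithDistinct j l * f (distinct l) ≡ ufrWithDistinct j l * f j
  ufrWithDistinct-distinct f with distinct l ≟ j
  ... | yes refl = refl
  ... | no d≢j rewrite ≡ᵇ-false d≢j | *-zeroʳ (toℕ (ufr l)) = refl

  ufrWithDistinct-*-cong : ∀ {a b} → (IsUFR l → a ≡ b) →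
                           ufrWithDistinct j l * a ≡ ufrWithDistinct j l * b
  ufrWithDistinct-*-cong a≡b with T? (ufr l)
  ... | yes isUfr = cong (ufrWithDistinct j l *_) (a≡b (Equivalence.to (T-ufr l) isUfr))
  ... | no ¬isUfr rewrite ¬T⇒≡false ¬isUfr = refl

  ufrWithDistinct-vanishes : ∀ b → (IsUFR l → ¬ T b) → ufrWithDistinct j l * toℕ b ≡ 0
  ufrWithDistinct-vanishes b excluded =
    trans (ufrWithDistinct-*-cong (cong toℕ ∘ ¬T⇒≡false ∘ excluded)) (*-zeroʳ (ufrWithDistinct j l))

module StrictlyMonotone {g : ℕ → ℕ} (g-mono : g Preserves _<_ ⟶ _<_) where

  <ᵇ-preserved : ∀ c b → (g c <ᵇ g b) ≡ (c <ᵇ b)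
  <ᵇ-preserved c b with <-cmp c b
  ... | tri< c<b _ _  rewrite <ᵇ-true c<b | <ᵇ-true (g-mono c<b) = refl
  ... | tri≈ _ refl _ rewrite <ᵇ-false (≤-refl {c}) | <ᵇ-false (≤-refl {g c}) = refl
  ... | tri> _ _ c>b  rewrite <ᵇ-false (<⇒≤ c>b) | <ᵇ-false (<⇒≤ (g-mono c>b)) = refl

  ≡ᵇ-preserved : ∀ c b → (g c ≡ᵇ g b) ≡ (c ≡ᵇ b)
  ≡ᵇ-preserved c b with <-cmp c b
  ... | tri< c<b _ _  rewrite ≡ᵇ-false (<⇒≢ c<b) | ≡ᵇ-false (<⇒≢ (g-mono c<b)) = refl
  ... | tri≈ _ refl _ rewrite ≡ᵇ-true {c} refl | ≡ᵇ-true {g c} refl = refl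
  ... | tri> _ _ c>b  rewrite ≡ᵇ-false (>⇒≢ c>b) | ≡ᵇ-false (>⇒≢ (g-mono c>b)) = refl

  below-map : ∀ b u → below (g b) (map g u) ≡ below b u
  below-map b u = trans (countB-map _ g u) (countB-cong (λ c → <ᵇ-preserved c b) u)

  count-map : ∀ b u → count (g b) (map g u) ≡ count b u
  count-map b u = trans (countB-map _ g u) (countB-cong (λ c → ≡ᵇ-preserved c b) u)

  ∈ᵇ-map : ∀ a u → (g a ∈ᵇ map g u) ≡ (a ∈ᵇ u)
  ∈ᵇ-map a []      = refl
  ∈ᵇ-map a (c ∷ u) = cong₂ _∨_ (≡ᵇ-preserved c a) (∈ᵇ-map a u)

  distinct-map : ∀ u → distinct (map g u) ≡ distinct u
  distinct-map []      = refl
  distinct-map (a ∷ u) = cong₂ _+_ (cong (toℕ ∘ not) (∈ᵇ-map a u)) (distinct-map u)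

punchIn : ℕ → ℕ → ℕ
punchIn t y = if y <ᵇ t then y else suc y

punchIn-< : ∀ {t y} → y < t → punchIn t y ≡ y
punchIn-< y<t rewrite <ᵇ-true y<t = refl

punchIn-≥ : ∀ {t y} → t ≤ y → punchIn t y ≡ suc y
punchIn-≥ t≤y rewrite <ᵇ-false t≤y = refl

punchIn-mono : ∀ t → punchIn t Preserves _<_ ⟶ _<_
punchIn-mono t {c} {b} c<b with c <? t | b <? t
... | yes c<t | yes b<t rewrite punchIn-< c<t | punchIn-< b<t = c<b
... | yes c<t | no b≮t  rewrite punchIn-< c<t | punchIn-≥ (≮⇒≥ b≮t) = m<n⇒m<1+n c<b
... | no c≮t  | yes b<t = contradiction (<-trans c<b b<t) c≮t
... | no c≮t  | no b≮t  rewrite punchIn-≥ (≮⇒≥ c≮t) | punchIn-≥ (≮⇒≥ b≮t) = s<s c<b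

punchIn-≢ : ∀ t y → punchIn t y ≢ t
punchIn-≢ t y with y <? t
... | yes y<t rewrite punchIn-< y<t = <⇒≢ y<t
... | no y≮t  rewrite punchIn-≥ (≮⇒≥ y≮t) = >⇒≢ (s≤s (≮⇒≥ y≮t))

-- A new first entry h in front of u, with the values of u from t on shifted up:
-- t = h makes h a new value, t = h + 1 a second copy of h.
module Insertion (h t : ℕ) (h≤t : h ≤ t) (t≤1+h : t ≤ suc h) where
  open StrictlyMonotone (punchIn-mono t)

  inserted : List ℕ → List ℕ
  inserted u = h ∷ map (punchIn t) u

  punchIn-rank : ∀ b → punchIn t b ≡ toℕ (h <ᵇ punchIn t b) + b
  punchIn-rank b with b <? t
  ... | yes b<t rewrite punchIn-< b<t | <ᵇ-false {h} {b} (≤-pred (<-≤-trans b<t t≤1+h)) = refl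
  ... | no b≮t  rewrite punchIn-≥ (≮⇒≥ b≮t)
                      | <ᵇ-true {h} {suc b} (s≤s (≤-trans h≤t (≮⇒≥ b≮t))) = refl

  punchIn-<ᵇ-h : ∀ c → (punchIn t c <ᵇ h) ≡ (c <ᵇ h)
  punchIn-<ᵇ-h c with c <? t
  ... | yes c<t rewrite punchIn-< c<t = refl
  ... | no c≮t  rewrite punchIn-≥ (≮⇒≥ c≮t) | <ᵇ-false {c} {h} (≤-trans h≤t (≮⇒≥ c≮t))
                      | <ᵇ-false {suc c} {h} (m≤n⇒m≤1+n (≤-trans h≤t (≮⇒≥ c≮t))) = refl

  below-inserted-h : ∀ u → below h (inserted u) ≡ below h u
  below-inserted-h u rewrite <ᵇ-false (≤-refl {h}) =
    trans (countB-map _ (punchIn t) u) (countB-cong punchIn-<ᵇ-h u)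

  rank-inserted : ∀ b u → punchIn t b ≡ suc (below (punchIn t b) (inserted u)) ⇔ b ≡ suc (below b u)
  rank-inserted b u = mk⇔
    (λ e → +-cancelˡ-≡ δ b (suc (below b u)) (trans (sym (punchIn-rank b)) (trans e shift)))
    (λ e → trans (punchIn-rank b) (trans (cong (δ +_) e) (sym shift)))
    where
    δ : ℕ
    δ = toℕ (h <ᵇ punchIn t b)
    shift : suc (below (punchIn t b) (inserted u)) ≡ δ + suc (below b u)
    shift = trans (cong suc (trans (countB-∷ (_<ᵇ punchIn t b) h (map (punchIn t) u))
                                   (cong (δ +_) (below-map b u))))
                  (sym (+-suc δ (below b u)))

  isFubini-inserted : ∀ u → IsFubini (inserted u) ⇔ (h ≡ suc (below h u) × IsFubini u)
  isFubini-inserted u = mk⇔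
    (λ { (h-rank ∷ fub) → trans h-rank (cong suc (below-inserted-h u))
                        , All.map (Equivalence.to (rank-inserted _ u)) (map⁻ fub) })
    (λ { (h-rank , fub) → trans h-rank (cong suc (sym (below-inserted-h u)))
                        ∷ map⁺ (All.map (Equivalence.from (rank-inserted _ u)) fub) })

module InsertFresh (x : ℕ) where
  open StrictlyMonotone (punchIn-mono x)
  open Insertion x x ≤-refl (n≤1+n x)

  ∈ᵇ-punchIn-self : ∀ u → (x ∈ᵇ map (punchIn x) u) ≡ false
  ∈ᵇ-punchIn-self []      = refl
  ∈ᵇ-punchIn-self (c ∷ u) rewrite ≡ᵇ-false (punchIn-≢ x c) = ∈ᵇ-punchIn-self u

  count-self : ∀ u → count x (inserted u) ≡ 1
  count-self u = trans (count-here x (map (punchIn x) u))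
                       (cong suc (∉ᵇ⇒count≡0 (map (punchIn x) u) (subst T (∈ᵇ-punchIn-self u))))

  count-fresh : ∀ b u → count (punchIn x b) (inserted u) ≡ count b u
  count-fresh b u rewrite ≡ᵇ-false (punchIn-≢ x b ∘ sym) = count-map b u

  isUnit-fresh : ∀ u → IsUnit (inserted u) ⇔ IsUnit u
  isUnit-fresh u = mk⇔
    (λ { (_ ∷ unit) → All.map (λ {b} → subst (_≤ 2) (count-fresh b u)) (map⁻ unit) })
    (λ unit → subst (_≤ 2) (sym (count-self u)) (s≤s z≤n)
            ∷ map⁺ (All.map (λ {b} → subst (_≤ 2) (sym (count-fresh b u))) unit))

  isUFR-fresh : ∀ {n u} → All (_≤ n) u → length u ≡ n → x ≤ suc n →
                IsUFR (inserted u) ⇔ (IsUFR u × (T (x ∈ᵇ u) ⊎ x ≡ suc n))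
  isUFR-fresh {n} {u} bounded len x≤1+n = mk⇔ to from
    where
    to : IsUFR (inserted u) → IsUFR u × (T (x ∈ᵇ u) ⊎ x ≡ suc n)
    to (fub , unit) with Equivalence.to (isFubini-inserted u) fub | x ≟ suc n
    ... | x-rank , fubᵤ | yes x≡1+n = (fubᵤ , Equivalence.to (isUnit-fresh u) unit) , inj₂ x≡1+n
    ... | x-rank , fubᵤ | no x≢1+n  =
      (fubᵤ , Equivalence.to (isUnit-fresh u) unit) , inj₁ (fubini-attained fubᵤ x-rank short)
      where
      short : below x u < length u
      short = subst₂ _≤_ x-rank (sym len) (≤-pred (≤∧≢⇒< x≤1+n x≢1+n))
    from : IsUFR u × (T (x ∈ᵇ u) ⊎ x ≡ suc n) → IsUFR (inserted u)
    from ((fubᵤ , unitᵤ) , where-x) =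
      Equivalence.from (isFubini-inserted u) (x-rank where-x , fubᵤ) ,
      Equivalence.from (isUnit-fresh u) unitᵤ
      where
      x-rank : T (x ∈ᵇ u) ⊎ x ≡ suc n → x ≡ suc (below x u)
      x-rank (inj₁ x∈u)  = All-∈ᵇ fubᵤ x∈u
      x-rank (inj₂ refl) = cong suc (sym (trans (countB-all _ (All.map (<⇒<ᵇ ∘ s≤s) bounded)) len))

  distinct-fresh : ∀ u → distinct (inserted u) ≡ suc (distinct u)
  distinct-fresh u rewrite ∈ᵇ-punchIn-self u = cong suc (distinct-map u)

  ufr-fresh : ∀ {n u} → All (_≤ n) u → length u ≡ n → x ≤ suc n →
              toℕ (ufr (inserted u)) ≡ toℕ (ufr u) * toℕ ((x ∈ᵇ u) ∨ (x ≡ᵇ suc n))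
  ufr-fresh {n} {u} bounded len x≤1+n = trans (toℕ-cong (mk⇔ to from)) (toℕ-∧ (ufr u) _)
    where
    ufr⇔ : IsUFR (inserted u) ⇔ (IsUFR u × (T (x ∈ᵇ u) ⊎ x ≡ suc n))
    ufr⇔ = isUFR-fresh bounded len x≤1+n
    to : T (ufr (inserted u)) → T (ufr u ∧ ((x ∈ᵇ u) ∨ (x ≡ᵇ suc n)))
    to t with Equivalence.to ufr⇔ (Equivalence.to (T-ufr _) t)
    ... | ufrᵤ , where-x = Equivalence.from T-∧
      (Equivalence.from (T-ufr u) ufrᵤ , Equivalence.from T-∨ (Sum.map₂ (≡⇒≡ᵇ x (suc n)) where-x))
    from : T (ufr u ∧ ((x ∈ᵇ u) ∨ (x ≡ᵇ suc n))) → T (ufr (inserted u))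
    from t with Equivalence.to T-∧ t
    ... | tᵤ , where-x = Equivalence.from (T-ufr _) (Equivalence.from ufr⇔
      (Equivalence.to (T-ufr u) tᵤ , Sum.map₂ (≡ᵇ⇒≡ x (suc n)) (Equivalence.to T-∨ where-x)))

  ufrWithDistinct-fresh : ∀ {n k u} → All (_≤ n) u → length u ≡ n → x ≤ suc n →
                          ufrWithDistinct (suc k) (inserted u) * toℕ (not (x ∈ᵇ map (punchIn x) u))
                          ≡ ufrWithDistinct k u * toℕ ((x ∈ᵇ u) ∨ (x ≡ᵇ suc n))
  ufrWithDistinct-fresh {n} {k} {u} bounded len x≤1+n = begin
    ufrWithDistinct (suc k) (inserted u) * toℕ (not (x ∈ᵇ map (punchIn x) u))
      ≡⟨ cong (λ b → ufrWithDistinct (suc k) (inserted u) * toℕ (not b)) (∈ᵇ-punchIn-self u) ⟩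
    ufrWithDistinct (suc k) (inserted u) * 1
      ≡⟨ *-identityʳ _ ⟩
    toℕ (ufr (inserted u)) * toℕ (distinct (inserted u) ≡ᵇ suc k)
      ≡⟨ cong₂ (λ a d → a * toℕ (d ≡ᵇ suc k)) (ufr-fresh bounded len x≤1+n) (distinct-fresh u) ⟩
    toℕ (ufr u) * toℕ ((x ∈ᵇ u) ∨ (x ≡ᵇ suc n)) * toℕ (distinct u ≡ᵇ k)
      ≡⟨ *-right-comm (toℕ (ufr u)) _ _ ⟩
    toℕ (ufr u) * toℕ (distinct u ≡ᵇ k) * toℕ ((x ∈ᵇ u) ∨ (x ≡ᵇ suc n)) ∎
    where open ≡-Reasoning

module InsertRepeat (x : ℕ) where
  open StrictlyMonotone (punchIn-mono (suc x))
  open Insertion x (suc x) (n≤1+n x) ≤-refl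

  punchIn-self : punchIn (suc x) x ≡ x
  punchIn-self = punchIn-< (n<1+n x)

  ∈ᵇ-repeat : ∀ u → (x ∈ᵇ map (punchIn (suc x)) u) ≡ (x ∈ᵇ u)
  ∈ᵇ-repeat u =
    subst (λ y → (y ∈ᵇ map (punchIn (suc x)) u) ≡ (x ∈ᵇ u)) punchIn-self (∈ᵇ-map x u)

  count-self : ∀ u → count x (inserted u) ≡ suc (count x u)
  count-self u = trans (count-here x (map (punchIn (suc x)) u))
    (cong suc (subst (λ y → count y (map (punchIn (suc x)) u) ≡ count x u) punchIn-self (count-map x u)))

  count-repeat : ∀ b u → count (punchIn (suc x) b) (inserted u) ≡ toℕ (x ≡ᵇ b) + count b u
  count-repeat b u = begin
    count (punchIn (suc x) b) (inserted u)
      ≡⟨ countB-∷ (_≡ᵇ punchIn (suc x) b) x (map (punchIn (suc x)) u) ⟩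
    toℕ (x ≡ᵇ punchIn (suc x) b) + count (punchIn (suc x) b) (map (punchIn (suc x)) u)
      ≡⟨ cong₂ (λ y c → toℕ (y ≡ᵇ punchIn (suc x) b) + c) (sym punchIn-self) (count-map b u) ⟩
    toℕ (punchIn (suc x) x ≡ᵇ punchIn (suc x) b) + count b u
      ≡⟨ cong (λ e → toℕ e + count b u) (≡ᵇ-preserved x b) ⟩
    toℕ (x ≡ᵇ b) + count b u ∎
    where open ≡-Reasoning

  isUFR-repeat : ∀ u → (IsUFR (inserted u) × T (x ∈ᵇ u)) ⇔ (IsUFR u × count x u ≡ 1)
  isUFR-repeat u = mk⇔ to from
    where
    to : IsUFR (inserted u) × T (x ∈ᵇ u) → IsUFR u × count x u ≡ 1
    to ((fub , x-twice ∷ unit) , x∈u) =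
      (proj₂ (Equivalence.to (isFubini-inserted u) fub) , All.map drop-x (map⁻ unit)) ,
      ≤-antisym (s≤s⁻¹ (subst (_≤ 2) (count-self u) x-twice)) (∈ᵇ⇒count-pos u x∈u)
      where
      drop-x : ∀ {b} → count (punchIn (suc x) b) (inserted u) ≤ 2 → count b u ≤ 2
      drop-x {b} c≤2 = ≤-trans (m≤n+m (count b u) _) (subst (_≤ 2) (count-repeat b u) c≤2)
    from : IsUFR u × count x u ≡ 1 → IsUFR (inserted u) × T (x ∈ᵇ u)
    from ((fubᵤ , unitᵤ) , once) = (fub , unit) , x∈u
      where
      x∈u : T (x ∈ᵇ u)
      x∈u = count-pos⇒∈ᵇ u (subst (0 <_) (sym once) z<s)
      fub : IsFubini (inserted u)
      fub = Equivalence.from (isFubini-inserted u) (All-∈ᵇ fubᵤ x∈u , fubᵤ)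
      add-x : ∀ {b} → count b u ≤ 2 → count (punchIn (suc x) b) (inserted u) ≤ 2
      add-x {b} c≤2 with x ≟ b
      ... | yes refl rewrite count-repeat x u | ≡ᵇ-true {x} refl | once = ≤-refl
      ... | no x≢b   rewrite count-repeat b u | ≡ᵇ-false x≢b = c≤2
      unit : IsUnit (inserted u)
      unit = subst (_≤ 2) (sym (trans (count-self u) (cong suc once))) ≤-refl
           ∷ map⁺ (All.map add-x unitᵤ)

  distinct-repeat : ∀ u → T (x ∈ᵇ u) → distinct (inserted u) ≡ distinct u
  distinct-repeat u x∈u rewrite ∈ᵇ-repeat u | Equivalence.to T-≡ x∈u = distinct-map u

  ufr-repeat : ∀ u → toℕ (ufr (inserted u)) * toℕ (x ∈ᵇ u) ≡ toℕ (ufr u) * toℕ (count x u ≡ᵇ 1)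
  ufr-repeat u = trans (sym (toℕ-∧ (ufr (inserted u)) _))
                       (trans (toℕ-cong (mk⇔ to from)) (toℕ-∧ (ufr u) _))
    where
    to : T (ufr (inserted u) ∧ (x ∈ᵇ u)) → T (ufr u ∧ (count x u ≡ᵇ 1))
    to t with Equivalence.to T-∧ t
    ... | t-ufr , x∈u with Equivalence.to (isUFR-repeat u) (Equivalence.to (T-ufr _) t-ufr , x∈u)
    ...   | ufrᵤ , once = Equivalence.from T-∧ (Equivalence.from (T-ufr u) ufrᵤ , ≡⇒≡ᵇ _ 1 once)
    from : T (ufr u ∧ (count x u ≡ᵇ 1)) → T (ufr (inserted u) ∧ (x ∈ᵇ u))
    from t with Equivalence.to T-∧ t
    ... | t-ufr , once
      with Equivalence.from (isUFR-repeat u) (Equivalence.to (T-ufr u) t-ufr , ≡ᵇ⇒≡ _ 1 once)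
    ...   | ufr-v , x∈u = Equivalence.from T-∧ (Equivalence.from (T-ufr _) ufr-v , x∈u)

  ufrWithDistinct-repeat : ∀ {k} u →
                           ufrWithDistinct (suc k) (inserted u) * toℕ (x ∈ᵇ map (punchIn (suc x)) u)
                           ≡ ufrWithDistinct (suc k) u * toℕ (count x u ≡ᵇ 1)
  ufrWithDistinct-repeat {k} u with T? (x ∈ᵇ u)
  ... | no x∉u = begin
    ufrWithDistinct (suc k) (inserted u) * toℕ (x ∈ᵇ map (punchIn (suc x)) u)
      ≡⟨ cong (λ b → ufrWithDistinct (suc k) (inserted u) * toℕ b)
              (trans (∈ᵇ-repeat u) (¬T⇒≡false x∉u)) ⟩
    ufrWithDistinct (suc k) (inserted u) * 0
      ≡⟨ *-zeroʳ (ufrWithDistinct (suc k) (inserted u)) ⟩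
    0
      ≡⟨ sym (*-zeroʳ (ufrWithDistinct (suc k) u)) ⟩
    ufrWithDistinct (suc k) u * toℕ (0 ≡ᵇ 1)
      ≡⟨ cong (λ c → ufrWithDistinct (suc k) u * toℕ (c ≡ᵇ 1)) (sym (∉ᵇ⇒count≡0 u x∉u)) ⟩
    ufrWithDistinct (suc k) u * toℕ (count x u ≡ᵇ 1) ∎
    where open ≡-Reasoning
  ... | yes x∈u = begin
    toℕ (ufr v) * toℕ (distinct v ≡ᵇ suc k) * toℕ (x ∈ᵇ map (punchIn (suc x)) u)
      ≡⟨ cong (λ b → toℕ (ufr v) * toℕ (distinct v ≡ᵇ suc k) * toℕ b) (∈ᵇ-repeat u) ⟩
    toℕ (ufr v) * toℕ (distinct v ≡ᵇ suc k) * toℕ (x ∈ᵇ u)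
      ≡⟨ *-right-comm (toℕ (ufr v)) _ _ ⟩
    toℕ (ufr v) * toℕ (x ∈ᵇ u) * toℕ (distinct v ≡ᵇ suc k)
      ≡⟨ cong₂ (λ a d → a * toℕ (d ≡ᵇ suc k)) (ufr-repeat u) (distinct-repeat u x∈u) ⟩
    toℕ (ufr u) * toℕ (count x u ≡ᵇ 1) * toℕ (distinct u ≡ᵇ suc k)
      ≡⟨ *-right-comm (toℕ (ufr u)) _ _ ⟩
    toℕ (ufr u) * toℕ (distinct u ≡ᵇ suc k) * toℕ (count x u ≡ᵇ 1) ∎
    where
    open ≡-Reasoning
    v : List ℕ
    v = inserted u

firstFree-free : ∀ fuel {a occ} → ¬ T (a ∈ᵇ occ) → firstFree fuel a occ ≡ a
firstFree-free zero       _   = refl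
firstFree-free (suc fuel) a∉ rewrite ¬T⇒≡false a∉ = refl

firstFree-next : ∀ fuel {a occ} → T (a ∈ᵇ occ) → ¬ T (suc a ∈ᵇ occ) →
                 firstFree (suc fuel) a occ ≡ suc a
firstFree-next fuel {a} a∈ sa∉ rewrite Equivalence.to T-≡ a∈ = firstFree-free fuel {suc a} sa∉

luckyAux-∷ : ∀ fuel occ a s {spot} → firstFree fuel a occ ≡ spot →
             luckyAux fuel occ (a ∷ s) ≡ (if spot ≡ᵇ a then 1 else 0) + luckyAux fuel (spot ∷ occ) s
luckyAux-∷ fuel occ a s refl = refl

newValues : List ℕ → List ℕ → ℕ
newValues seen []      = 0
newValues seen (a ∷ s) = toℕ (not (a ∈ᵇ seen)) + newValues (a ∷ seen) s

newValues-distinct : ∀ p s → newValues p s + distinct p ≡ distinct (p ++ s)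
newValues-distinct p []      = cong distinct (sym (++-identityʳ p))
newValues-distinct p (a ∷ s) = begin
  new + newValues (a ∷ p) s + distinct p   ≡⟨ +-assoc new (newValues (a ∷ p) s) (distinct p) ⟩
  new + (newValues (a ∷ p) s + distinct p) ≡⟨ +-left-comm new (newValues (a ∷ p) s) (distinct p) ⟩
  newValues (a ∷ p) s + distinct (a ∷ p)   ≡⟨ newValues-distinct (a ∷ p) s ⟩
  distinct (a ∷ p ++ s)                    ≡⟨ sym (distinct-move p a s) ⟩
  distinct (p ++ a ∷ s)                    ∎
  where
  open ≡-Reasoning
  new : ℕ
  new = toℕ (not (a ∈ᵇ p))

-- p lists the preferences of the cars already parked, latest first, s those of the cars to come,
-- and occ the occupied spots.
record Parkable (p s : List ℕ) : Set where
  field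
    at-most-twice : ∀ a → count a p + count a s ≤ 2
    gap-after-tie : ∀ b → 2 ≤ count b p + count b s → count (suc b) p + count (suc b) s ≡ 0

record Occupancy (p occ : List ℕ) : Set where
  field
    preferred-occupied : ∀ {b} → T (b ∈ᵇ p) → T (b ∈ᵇ occ)
    occupied-explained : ∀ {t} → T (t ∈ᵇ occ) → T (t ∈ᵇ p) ⊎ ∃[ b ] t ≡ suc b × 2 ≤ count b p

count-pending : ∀ c p s → suc (count c p) ≤ count c p + count c (c ∷ s)
count-pending c p s = subst (suc (count c p) ≤_)
  (sym (trans (cong (count c p +_) (count-here c s)) (+-suc (count c p) (count c s))))
  (s≤s (m≤m+n (count c p) (count c s)))

module _ {a : ℕ} {p s : List ℕ} (par : Parkable p (a ∷ s)) where
  open Parkable par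

  count-moved : ∀ c → count c (a ∷ p) + count c s ≡ count c p + count c (a ∷ s)
  count-moved c rewrite countB-∷ (_≡ᵇ c) a p | countB-∷ (_≡ᵇ c) a s =
    trans (+-assoc (toℕ (a ≡ᵇ c)) _ _) (+-left-comm (toℕ (a ≡ᵇ c)) (count c p) (count c s))

  parkable-∷ : Parkable (a ∷ p) s
  parkable-∷ = record
    { at-most-twice = λ c → subst (_≤ 2) (sym (count-moved c)) (at-most-twice c)
    ; gap-after-tie = λ b tie →
        trans (count-moved (suc b)) (gap-after-tie b (subst (2 ≤_) (count-moved b) tie))
    }

  module _ {occ : List ℕ} (occupancy : Occupancy p occ) where
    open Occupancy occupancy

    fresh-unoccupied : ¬ T (a ∈ᵇ p) → ¬ T (a ∈ᵇ occ)
    fresh-unoccupied a∉p a∈occ with occupied-explained a∈occ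
    ... | inj₁ a∈p              = a∉p a∈p
    ... | inj₂ (b , refl , tie) = contradiction
      (subst (suc (count (suc b) p) ≤_) (gap-after-tie b (≤-trans tie (m≤m+n _ _)))
             (count-pending (suc b) p s))
      λ ()

    successor-unoccupied : T (a ∈ᵇ p) → ¬ T (suc a ∈ᵇ occ)
    successor-unoccupied a∈p sa∈occ with occupied-explained sa∈occ
    ... | inj₁ sa∈p = contradiction
      (subst (1 ≤_) no-successor (≤-trans (∈ᵇ⇒count-pos p sa∈p) (m≤m+n _ _)))
      λ ()
      where
      no-successor : count (suc a) p + count (suc a) (a ∷ s) ≡ 0
      no-successor = gap-after-tie a (≤-trans (s≤s (∈ᵇ⇒count-pos p a∈p)) (count-pending a p s))
    ... | inj₂ (.a , refl , tie) =
      <-irrefl refl (≤-trans (s≤s tie) (≤-trans (count-pending a p s) (at-most-twice a)))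

module _ {a : ℕ} {p occ : List ℕ} (occupancy : Occupancy p occ) where
  open Occupancy occupancy

  explained-∷ : ∀ {t} → T (t ∈ᵇ p) ⊎ ∃[ b ] t ≡ suc b × 2 ≤ count b p →
                T (t ∈ᵇ (a ∷ p)) ⊎ ∃[ b ] t ≡ suc b × 2 ≤ count b (a ∷ p)
  explained-∷ (inj₁ t∈p)            = inj₁ (∈ᵇ-there a p t∈p)
  explained-∷ (inj₂ (b , t≡ , tie)) = inj₂ (b , t≡ , ≤-trans tie (count-mono-∷ b a p))

  occupancy-lucky : Occupancy (a ∷ p) (a ∷ occ)
  occupancy-lucky = record
    { preferred-occupied = λ b∈ →
        Equivalence.from T-∨ (Sum.map₂ preferred-occupied (Equivalence.to T-∨ b∈))
    ; occupied-explained = λ t∈ →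
        [ (λ a≡t → inj₁ (Equivalence.from T-∨ (inj₁ a≡t))) , explained-∷ ∘ occupied-explained ]′
          (Equivalence.to T-∨ t∈)
    }

  occupancy-unlucky : T (a ∈ᵇ p) → Occupancy (a ∷ p) (suc a ∷ occ)
  occupancy-unlucky a∈p = record
    { preferred-occupied = λ b∈ → ∈ᵇ-there (suc a) occ (preferred-occupied
        ([ (λ a≡b → subst (λ b → T (b ∈ᵇ p)) (≡ᵇ⇒≡ a _ a≡b) a∈p) , id ]′
          (Equivalence.to T-∨ b∈)))
    ; occupied-explained = λ t∈ →
        [ (λ sa≡t → inj₂ (a , sym (≡ᵇ⇒≡ (suc a) _ sa≡t) , tie))
        , explained-∷ ∘ occupied-explained ]′ (Equivalence.to T-∨ t∈)
    }
    where
    tie : 2 ≤ count a (a ∷ p)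
    tie = subst (2 ≤_) (sym (count-here a p)) (s≤s (∈ᵇ⇒count-pos p a∈p))

-- A car never looks beyond the spot after its preference, so one unit of fuel suffices.
lucky-count : ∀ fuel s {p occ} → Parkable p s → Occupancy p occ →
              luckyAux (suc fuel) occ s ≡ newValues p s
lucky-count fuel []      _   _ = refl
lucky-count fuel (a ∷ s) {p} {occ} par occupancy with a ∈ᵇ p in a∈p?
... | false rewrite luckyAux-∷ (suc fuel) occ a s
                      (firstFree-free (suc fuel) {a} (fresh-unoccupied par occupancy (subst T a∈p?)))
                  | ≡ᵇ-true {a} refl
  = cong suc (lucky-count fuel s (parkable-∷ par) (occupancy-lucky occupancy))
... | true with Equivalence.from T-≡ a∈p?
...   | a∈p rewrite luckyAux-∷ (suc fuel) occ a s
                      (firstFree-next fuel {a} (Occupancy.preferred-occupied occupancy a∈p)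
                                           (successor-unoccupied par occupancy a∈p))
                  | ≡ᵇ-false (1+n≢n {a})
  = lucky-count fuel s (parkable-∷ par) (occupancy-unlucky occupancy a∈p)

luckyCars-ufr : ∀ {m} (v : Vec ℕ m) → IsUFR (toList v) → luckyCars v ≡ distinct (toList v)
luckyCars-ufr {zero}  []  _            = refl
luckyCars-ufr {suc m} v   (fub , unit) = begin
  luckyAux (suc m) [] (toList v) ≡⟨ lucky-count m (toList v) parkable nothing-parked ⟩
  newValues [] (toList v)        ≡⟨ sym (+-identityʳ _) ⟩
  newValues [] (toList v) + 0    ≡⟨ newValues-distinct [] (toList v) ⟩
  distinct (toList v)            ∎
  where
  open ≡-Reasoning
  parkable : Parkable [] (toList v)
  parkable = record { at-most-twice = isUnit⇒count≤2 unit ; gap-after-tie = λ _ → fubini-gap fub }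
  nothing-parked : Occupancy [] []
  nothing-parked = record { preferred-occupied = λ () ; occupied-explained = λ () }

ufrCount : ℕ → ℕ → ℕ
ufrCount m j = ∑[ v ∈ candidates m ] ufrWithDistinct j (toList v)

fUFR≡ufrCount : ∀ m j → fUFR m j ≡ ufrCount m j
fUFR≡ufrCount m j = trans (length-filter-T (λ v → isUFRB v ∧ (luckyCars v ≡ᵇ j)) (candidates m))
                          (∑-cong lucky≡distinct (candidates m))
  where
  lucky≡distinct : ∀ v → toℕ (ufr (toList v) ∧ (luckyCars v ≡ᵇ j)) ≡ ufrWithDistinct j (toList v)
  lucky≡distinct v with T? (ufr (toList v))
  ... | yes isUfr rewrite luckyCars-ufr v (Equivalence.to (T-ufr _) isUfr) = toℕ-∧ (ufr (toList v)) _
  ... | no ¬isUfr rewrite ¬T⇒≡false ¬isUfr = refl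

oneTo : ℕ → List ℕ
oneTo m = map suc (upTo m)

InOneTo : ℕ → ℕ → Set
InOneTo m y = 1 ≤ y × y ≤ m

oneTo-bounds : ∀ m → All (InOneTo m) (oneTo m)
oneTo-bounds m = map⁺ (applyUpTo⁺₁ id m (λ i<m → s≤s z≤n , i<m))

∑-oneTo-suc : ∀ (F : ℕ → ℕ) m → ∑ (oneTo (suc m)) F ≡ ∑ (oneTo m) F + F (suc m)
∑-oneTo-suc F m = begin
  ∑ (map suc (upTo (suc m))) F    ≡⟨ cong (λ l → ∑ (map suc l) F) (sym (upTo-∷ʳ m)) ⟩
  ∑ (map suc (upTo m ++ [ m ])) F ≡⟨ cong (λ l → ∑ l F) (map-++ suc (upTo m) [ m ]) ⟩
  ∑ (oneTo m ++ [ suc m ]) F      ≡⟨ ∑-++ F (oneTo m) [ suc m ] ⟩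
  ∑ (oneTo m) F + (F (suc m) + 0) ≡⟨ cong (∑ (oneTo m) F +_) (+-identityʳ (F (suc m))) ⟩
  ∑ (oneTo m) F + F (suc m)       ∎
  where open ≡-Reasoning

∑-oneTo-above : ∀ (F : ℕ → ℕ) m → (∀ {x} → x ≤ m → F x ≡ 0) → ∑ (oneTo m) F ≡ 0
∑-oneTo-above F m F≡0 = trans (∑-cong-All (F≡0 ∘ proj₂) (oneTo-bounds m)) (∑-zero (oneTo m))

∑-oneTo-δ : ∀ (G : ℕ → ℕ) {a} m → 1 ≤ a → a ≤ m →
            ∑[ x ∈ oneTo m ] (toℕ (a ≡ᵇ x) * G x) ≡ G a
∑-oneTo-δ G {a} zero    1≤a a≤0 = contradiction (≤-trans 1≤a a≤0) λ ()
∑-oneTo-δ G {a} (suc m) 1≤a a≤1+m with a ≟ suc m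
... | yes refl = begin
  ∑[ x ∈ oneTo (suc m) ] (toℕ (a ≡ᵇ x) * G x)                        ≡⟨ ∑-oneTo-suc _ m ⟩
  ∑[ x ∈ oneTo m ] (toℕ (a ≡ᵇ x) * G x) + toℕ (a ≡ᵇ a) * G a
    ≡⟨ cong₂ _+_ (∑-oneTo-above _ m λ {x} x≤m →
                    cong (λ b → toℕ b * G x) (≡ᵇ-false (>⇒≢ (s≤s x≤m))))
                 (cong (λ b → toℕ b * G a) (≡ᵇ-true {a} refl)) ⟩
  0 + 1 * G a                                                        ≡⟨ *-identityˡ (G a) ⟩
  G a                                                                ∎
  where open ≡-Reasoning
... | no a≢1+m = begin
  ∑[ x ∈ oneTo (suc m) ] (toℕ (a ≡ᵇ x) * G x)                        ≡⟨ ∑-oneTo-suc _ m ⟩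
  ∑[ x ∈ oneTo m ] (toℕ (a ≡ᵇ x) * G x) + toℕ (a ≡ᵇ suc m) * G (suc m)
    ≡⟨ cong₂ _+_ (∑-oneTo-δ G m 1≤a (≤-pred (≤∧≢⇒< a≤1+m a≢1+m)))
                 (cong (λ b → toℕ b * G (suc m)) (≡ᵇ-false a≢1+m)) ⟩
  G a + 0                                                            ≡⟨ +-identityʳ (G a) ⟩
  G a                                                                ∎
  where open ≡-Reasoning

∑-oneTo-punchIn : ∀ (F : ℕ → ℕ) {x} m → 1 ≤ x → x ≤ suc m → F x ≡ 0 →
                  ∑ (oneTo (suc m)) F ≡ ∑[ z ∈ oneTo m ] F (punchIn x z)
∑-oneTo-punchIn F {x} m 1≤x x≤1+m Fx≡0 with x ≟ suc m
∑-oneTo-punchIn F m _ _ Fx≡0 | yes refl = begin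
  ∑ (oneTo (suc m)) F       ≡⟨ ∑-oneTo-suc F m ⟩
  ∑ (oneTo m) F + F (suc m) ≡⟨ cong (∑ (oneTo m) F +_) Fx≡0 ⟩
  ∑ (oneTo m) F + 0         ≡⟨ +-identityʳ _ ⟩
  ∑ (oneTo m) F
    ≡⟨ ∑-cong-All (λ (_ , z≤m) → cong F (sym (punchIn-< (s≤s z≤m)))) (oneTo-bounds m) ⟩
  ∑[ z ∈ oneTo m ] F (punchIn (suc m) z) ∎
  where open ≡-Reasoning
∑-oneTo-punchIn F zero    1≤x x≤1 _ | no x≢1 = contradiction (≤-antisym x≤1 1≤x) x≢1
∑-oneTo-punchIn F {x} (suc m) 1≤x x≤2+m Fx≡0 | no x≢2+m = begin
  ∑ (oneTo (suc (suc m))) F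
    ≡⟨ ∑-oneTo-suc F (suc m) ⟩
  ∑ (oneTo (suc m)) F + F (suc (suc m))
    ≡⟨ cong₂ _+_ (∑-oneTo-punchIn F m 1≤x x≤1+m Fx≡0) (cong F (sym (punchIn-≥ x≤1+m))) ⟩
  ∑[ z ∈ oneTo m ] F (punchIn x z) + F (punchIn x (suc m))
    ≡⟨ sym (∑-oneTo-suc (F ∘ punchIn x) m) ⟩
  ∑[ z ∈ oneTo (suc m) ] F (punchIn x z) ∎
  where
  open ≡-Reasoning
  x≤1+m : x ≤ suc m
  x≤1+m = ≤-pred (≤∧≢⇒< x≤2+m x≢2+m)

∑-allVecs-suc : ∀ vals n (f : Vec ℕ (suc n) → ℕ) →
                ∑ (allVecs vals (suc n)) f ≡ ∑[ y ∈ vals ] ∑[ w ∈ allVecs vals n ] f (y ∷ w)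
∑-allVecs-suc vals n f =
  trans (∑-concatMap f _ vals) (∑-cong (λ y → ∑-map f (y ∷_) (allVecs vals n)) vals)

∑-allVecs-cong : ∀ {P : ℕ → Set} {vals} → All P vals → ∀ n {f g : Vec ℕ n → ℕ} →
                 (∀ w → All P (toList w) → f w ≡ g w) → ∑ (allVecs vals n) f ≡ ∑ (allVecs vals n) g
∑-allVecs-cong pvals zero    f≡g = cong (_+ 0) (f≡g [] [])
∑-allVecs-cong {vals = vals} pvals (suc n) {f} {g} f≡g = begin
  ∑ (allVecs vals (suc n)) f                      ≡⟨ ∑-allVecs-suc vals n f ⟩
  ∑[ y ∈ vals ] ∑[ w ∈ allVecs vals n ] f (y ∷ w)
    ≡⟨ ∑-cong-All (λ py → ∑-allVecs-cong pvals n (λ w pw → f≡g (_ ∷ w) (py ∷ pw))) pvals ⟩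
  ∑[ y ∈ vals ] ∑[ w ∈ allVecs vals n ] g (y ∷ w) ≡⟨ sym (∑-allVecs-suc vals n g) ⟩
  ∑ (allVecs vals (suc n)) g                      ∎
  where open ≡-Reasoning

tuples : ℕ → (n : ℕ) → List (Vec ℕ n)
tuples m n = allVecs (oneTo m) n

∑-tuples-avoiding : ∀ {x} m → 1 ≤ x → x ≤ suc m → ∀ n (f : Vec ℕ n → ℕ) →
                    (∀ w → T (x ∈ᵇ toList w) → f w ≡ 0) →
                    ∑ (tuples (suc m) n) f ≡ ∑[ u ∈ tuples m n ] f (Vec.map (punchIn x) u)
∑-tuples-avoiding m 1≤x x≤1+m zero    f _        = refl
∑-tuples-avoiding {x} m 1≤x x≤1+m (suc n) f f-avoids = begin
  ∑ (tuples (suc m) (suc n)) f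
    ≡⟨ ∑-allVecs-suc (oneTo (suc m)) n f ⟩
  ∑[ y ∈ oneTo (suc m) ] ∑[ w ∈ tuples (suc m) n ] f (y ∷ w)
    ≡⟨ ∑-cong (λ y → ∑-tuples-avoiding m 1≤x x≤1+m n (λ w → f (y ∷ w))
                       (λ w x∈w → f-avoids (y ∷ w) (∈ᵇ-there y (toList w) x∈w))) (oneTo (suc m)) ⟩
  ∑[ y ∈ oneTo (suc m) ] F y
    ≡⟨ ∑-oneTo-punchIn F m 1≤x x≤1+m (trans (∑-cong F-at-x (tuples m n)) (∑-zero (tuples m n))) ⟩
  ∑[ z ∈ oneTo m ] F (punchIn x z)
    ≡⟨ sym (∑-allVecs-suc (oneTo m) n (f ∘ Vec.map (punchIn x))) ⟩
  ∑ (tuples m (suc n)) (f ∘ Vec.map (punchIn x)) ∎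
  where
  open ≡-Reasoning
  F : ℕ → ℕ
  F y = ∑[ u ∈ tuples m n ] f (y ∷ Vec.map (punchIn x) u)
  F-at-x : ∀ u → f (x ∷ Vec.map (punchIn x) u) ≡ 0
  F-at-x u = f-avoids (x ∷ Vec.map (punchIn x) u) (∈ᵇ-here x (toList (Vec.map (punchIn x) u)))

∑-count≡length : ∀ m u → All (InOneTo m) u → ∑[ x ∈ oneTo m ] count x u ≡ length u
∑-count≡length m []      []                      = ∑-zero (oneTo m)
∑-count≡length m (a ∷ u) ((1≤a , a≤m) ∷ bounded) = begin
  ∑[ x ∈ oneTo m ] count x (a ∷ u)
    ≡⟨ ∑-cong (λ x → countB-∷ (_≡ᵇ x) a u) (oneTo m) ⟩
  ∑[ x ∈ oneTo m ] (toℕ (a ≡ᵇ x) + count x u)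
    ≡⟨ ∑-+ _ _ (oneTo m) ⟩
  ∑[ x ∈ oneTo m ] toℕ (a ≡ᵇ x) + ∑[ x ∈ oneTo m ] count x u
    ≡⟨ cong₂ _+_ once (∑-count≡length m u bounded) ⟩
  suc (length u) ∎
  where
  open ≡-Reasoning
  once : ∑[ x ∈ oneTo m ] toℕ (a ≡ᵇ x) ≡ 1
  once = trans (∑-cong (λ x → sym (*-identityʳ _)) (oneTo m)) (∑-oneTo-δ (λ _ → 1) m 1≤a a≤m)

∑-∈ᵇ≡distinct : ∀ m u → All (InOneTo m) u → ∑[ x ∈ oneTo m ] toℕ (x ∈ᵇ u) ≡ distinct u
∑-∈ᵇ≡distinct m []      []                      = ∑-zero (oneTo m)
∑-∈ᵇ≡distinct m (a ∷ u) ((1≤a , a≤m) ∷ bounded) = begin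
  ∑[ x ∈ oneTo m ] toℕ ((a ≡ᵇ x) ∨ (x ∈ᵇ u))
    ≡⟨ ∑-cong (λ x → toℕ-∨ (a ≡ᵇ x) (x ∈ᵇ u)) (oneTo m) ⟩
  ∑[ x ∈ oneTo m ] (toℕ (x ∈ᵇ u) + toℕ (a ≡ᵇ x) * toℕ (not (x ∈ᵇ u)))
    ≡⟨ ∑-+ _ _ (oneTo m) ⟩
  ∑[ x ∈ oneTo m ] toℕ (x ∈ᵇ u) + ∑[ x ∈ oneTo m ] (toℕ (a ≡ᵇ x) * toℕ (not (x ∈ᵇ u)))
    ≡⟨ cong₂ _+_ (∑-∈ᵇ≡distinct m u bounded)
                 (∑-oneTo-δ (λ x → toℕ (not (x ∈ᵇ u))) m 1≤a a≤m) ⟩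
  distinct u + toℕ (not (a ∈ᵇ u))
    ≡⟨ +-comm (distinct u) _ ⟩
  distinct (a ∷ u) ∎
  where open ≡-Reasoning

∑-∈ᵇ-or-top : ∀ n u → All (InOneTo n) u →
              ∑[ x ∈ oneTo (suc n) ] toℕ ((x ∈ᵇ u) ∨ (x ≡ᵇ suc n)) ≡ suc (distinct u)
∑-∈ᵇ-or-top n u bounded = begin
  ∑[ x ∈ oneTo (suc n) ] toℕ ((x ∈ᵇ u) ∨ (x ≡ᵇ suc n))
    ≡⟨ ∑-oneTo-suc _ n ⟩
  ∑[ x ∈ oneTo n ] toℕ ((x ∈ᵇ u) ∨ (x ≡ᵇ suc n)) + toℕ ((suc n ∈ᵇ u) ∨ (suc n ≡ᵇ suc n))
    ≡⟨ cong₂ _+_ (∑-cong-All below-top (oneTo-bounds n))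
                 (cong (λ b → toℕ ((suc n ∈ᵇ u) ∨ b)) (≡ᵇ-true {suc n} refl)) ⟩
  ∑[ x ∈ oneTo n ] toℕ (x ∈ᵇ u) + toℕ ((suc n ∈ᵇ u) ∨ true)
    ≡⟨ cong₂ _+_ (∑-∈ᵇ≡distinct n u bounded) (cong toℕ (∨-zeroʳ _)) ⟩
  distinct u + 1
    ≡⟨ +-comm (distinct u) 1 ⟩
  suc (distinct u) ∎
  where
  open ≡-Reasoning
  below-top : ∀ {x} → InOneTo n x → toℕ ((x ∈ᵇ u) ∨ (x ≡ᵇ suc n)) ≡ toℕ (x ∈ᵇ u)
  below-top {x} (_ , x≤n) =
    cong toℕ (trans (cong ((x ∈ᵇ u) ∨_) (≡ᵇ-false (<⇒≢ (s≤s x≤n)))) (∨-identityʳ _))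

singleton+count : ∀ c → c ≤ 2 → toℕ (c ≡ᵇ 1) + c ≡ 2 * toℕ (0 <ᵇ c)
singleton+count 0 _ = refl
singleton+count 1 _ = refl
singleton+count 2 _ = refl
singleton+count (suc (suc (suc c))) (s≤s (s≤s ()))

singletons : ℕ → List ℕ → ℕ
singletons n u = ∑[ x ∈ oneTo n ] toℕ (count x u ≡ᵇ 1)

singletons+n≡2*distinct : ∀ n u → All (InOneTo n) u → length u ≡ n → IsUnit u →
                          singletons n u + n ≡ 2 * distinct u
singletons+n≡2*distinct n u bounded len unit = begin
  singletons n u + n
    ≡⟨ cong (singletons n u +_) (sym (trans (∑-count≡length n u bounded) len)) ⟩
  singletons n u + ∑[ x ∈ oneTo n ] count x u
    ≡⟨ sym (∑-+ _ _ (oneTo n)) ⟩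
  ∑[ x ∈ oneTo n ] (toℕ (count x u ≡ᵇ 1) + count x u)
    ≡⟨ ∑-cong (λ x → trans (singleton+count (count x u) (isUnit⇒count≤2 unit x))
                           (cong (λ b → 2 * toℕ b) (sym (∈ᵇ-count x u)))) (oneTo n) ⟩
  ∑[ x ∈ oneTo n ] (2 * toℕ (x ∈ᵇ u))
    ≡⟨ ∑-*ˡ 2 _ (oneTo n) ⟩
  2 * ∑[ x ∈ oneTo n ] toℕ (x ∈ᵇ u)
    ≡⟨ cong (2 *_) (∑-∈ᵇ≡distinct n u bounded) ⟩
  2 * distinct u ∎
  where open ≡-Reasoning

module Recurrence (n k : ℕ) where

  weight : ℕ → Vec ℕ n → ℕ
  weight j u = ufrWithDistinct j (toList u)

  freshAt repeatedAt : ℕ → Vec ℕ n → ℕ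
  freshAt    x w = ufrWithDistinct (suc k) (x ∷ toList w) * toℕ (not (x ∈ᵇ toList w))
  repeatedAt x w = ufrWithDistinct (suc k) (x ∷ toList w) * toℕ (x ∈ᵇ toList w)

  firstFresh firstRepeated : ℕ
  firstFresh    = ∑[ x ∈ oneTo (suc n) ] ∑ (tuples (suc n) n) (freshAt x)
  firstRepeated = ∑[ x ∈ oneTo (suc n) ] ∑ (tuples (suc n) n) (repeatedAt x)

  ufrCount-split : ufrCount (suc n) (suc k) ≡ firstFresh + firstRepeated
  ufrCount-split = begin
    ufrCount (suc n) (suc k)
      ≡⟨ ∑-allVecs-suc (oneTo (suc n)) n _ ⟩
    ∑[ x ∈ oneTo (suc n) ] ∑[ w ∈ tuples (suc n) n ] ufrWithDistinct (suc k) (x ∷ toList w)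
      ≡⟨ ∑-cong (λ x → ∑-cong (λ w → split _ (x ∈ᵇ toList w)) (tuples (suc n) n))
                (oneTo (suc n)) ⟩
    ∑[ x ∈ oneTo (suc n) ] ∑[ w ∈ tuples (suc n) n ] (freshAt x w + repeatedAt x w)
      ≡⟨ ∑-cong (λ x → ∑-+ (freshAt x) (repeatedAt x) (tuples (suc n) n)) (oneTo (suc n)) ⟩
    ∑[ x ∈ oneTo (suc n) ] (∑ (tuples (suc n) n) (freshAt x) + ∑ (tuples (suc n) n) (repeatedAt x))
      ≡⟨ ∑-+ (λ x → ∑ (tuples (suc n) n) (freshAt x)) (λ x → ∑ (tuples (suc n) n) (repeatedAt x))
             (oneTo (suc n)) ⟩
    firstFresh + firstRepeated ∎
    where
    open ≡-Reasoning
    split : ∀ a b → a ≡ a * toℕ (not b) + a * toℕ b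
    split a false = sym (trans (cong₂ _+_ (*-identityʳ a) (*-zeroʳ a)) (+-identityʳ a))
    split a true  = sym (cong₂ _+_ (*-zeroʳ a) (*-identityʳ a))

  top-or-in : ℕ → Vec ℕ n → ℕ
  top-or-in x u = toℕ ((x ∈ᵇ toList u) ∨ (x ≡ᵇ suc n))

  freshAt-punchIn : ∀ {x} → 1 ≤ x → x ≤ suc n →
                    ∑ (tuples (suc n) n) (freshAt x) ≡ ∑[ u ∈ tuples n n ] (weight k u * top-or-in x u)
  freshAt-punchIn {x} 1≤x x≤1+n =
    trans (∑-tuples-avoiding n 1≤x x≤1+n n (freshAt x) absent)
          (∑-allVecs-cong (oneTo-bounds n) n removed)
    where
    absent : ∀ w → T (x ∈ᵇ toList w) → freshAt x w ≡ 0
    absent w x∈w = trans (cong (λ b → ufrWithDistinct (suc k) (x ∷ toList w) * toℕ (not b))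
                               (Equivalence.to T-≡ x∈w))
                         (*-zeroʳ (ufrWithDistinct (suc k) (x ∷ toList w)))
    removed : ∀ u → All (InOneTo n) (toList u) →
              freshAt x (Vec.map (punchIn x) u) ≡ weight k u * top-or-in x u
    removed u bounded rewrite toList-map (punchIn x) u =
      InsertFresh.ufrWithDistinct-fresh x (All.map proj₂ bounded) (length-toList u) x≤1+n

  repeatedAt-punchIn : ∀ {x} → 1 ≤ x → x ≤ n →
                       ∑ (tuples (suc n) n) (repeatedAt x)
                       ≡ ∑[ u ∈ tuples n n ] (weight (suc k) u * toℕ (count x (toList u) ≡ᵇ 1))
  repeatedAt-punchIn {x} 1≤x x≤n =
    trans (∑-tuples-avoiding n (s≤s z≤n) (s≤s x≤n) n (repeatedAt x) absent)
          (∑-cong removed (tuples n n))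
    where
    absent : ∀ w → T (suc x ∈ᵇ toList w) → repeatedAt x w ≡ 0
    absent w sx∈w = ufrWithDistinct-vanishes (suc k) (x ∷ toList w) (x ∈ᵇ toList w)
                      (λ (fub , _) x∈w → fubini-tied-successor fub x∈w sx∈w)
    removed : ∀ u → repeatedAt x (Vec.map (punchIn (suc x)) u)
                    ≡ weight (suc k) u * toℕ (count x (toList u) ≡ᵇ 1)
    removed u rewrite toList-map (punchIn (suc x)) u = InsertRepeat.ufrWithDistinct-repeat x (toList u)

  repeatedAt-top : ∑ (tuples (suc n) n) (repeatedAt (suc n)) ≡ 0
  repeatedAt-top = trans (∑-cong top-untied (tuples (suc n) n)) (∑-zero (tuples (suc n) n))
    where
    top-untied : ∀ w → repeatedAt (suc n) w ≡ 0
    top-untied w = ufrWithDistinct-vanishes (suc k) (suc n ∷ toList w) (suc n ∈ᵇ toList w)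
      λ (fub , _) sn∈w → <-irrefl (cong suc (sym (length-toList w))) (fubini-tied<length fub
        (subst (2 ≤_) (sym (count-here (suc n) (toList w))) (s≤s (∈ᵇ⇒count-pos (toList w) sn∈w))))

  firstFresh≡ : firstFresh ≡ suc k * ufrCount n k
  firstFresh≡ = begin
    firstFresh
      ≡⟨ ∑-cong-All (λ (1≤x , x≤1+n) → freshAt-punchIn 1≤x x≤1+n) (oneTo-bounds (suc n)) ⟩
    ∑[ x ∈ oneTo (suc n) ] ∑[ u ∈ tuples n n ] (weight k u * top-or-in x u)
      ≡⟨ ∑-comm _ (oneTo (suc n)) (tuples n n) ⟩
    ∑[ u ∈ tuples n n ] ∑[ x ∈ oneTo (suc n) ] (weight k u * top-or-in x u)
      ≡⟨ ∑-cong (λ u → ∑-*ˡ (weight k u) _ (oneTo (suc n))) (tuples n n) ⟩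
    ∑[ u ∈ tuples n n ] (weight k u * ∑[ x ∈ oneTo (suc n) ] top-or-in x u)
      ≡⟨ ∑-allVecs-cong (oneTo-bounds n) n
           (λ u bounded → cong (weight k u *_) (∑-∈ᵇ-or-top n _ bounded)) ⟩
    ∑[ u ∈ tuples n n ] (weight k u * suc (distinct (toList u)))
      ≡⟨ ∑-cong (λ u → trans (ufrWithDistinct-distinct k (toList u) suc) (*-comm _ (suc k)))
                (tuples n n) ⟩
    ∑[ u ∈ tuples n n ] (suc k * weight k u)
      ≡⟨ ∑-*ˡ (suc k) (weight k) (tuples n n) ⟩
    suc k * ufrCount n k ∎
    where open ≡-Reasoning

  firstRepeated≡ : firstRepeated ≡ ∑[ u ∈ tuples n n ] (weight (suc k) u * singletons n (toList u))
  firstRepeated≡ = begin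
    firstRepeated
      ≡⟨ ∑-oneTo-suc (λ x → ∑ (tuples (suc n) n) (repeatedAt x)) n ⟩
    ∑[ x ∈ oneTo n ] ∑ (tuples (suc n) n) (repeatedAt x) + ∑ (tuples (suc n) n) (repeatedAt (suc n))
      ≡⟨ cong₂ _+_ (∑-cong-All (λ (1≤x , x≤n) → repeatedAt-punchIn 1≤x x≤n) (oneTo-bounds n))
                   repeatedAt-top ⟩
    ∑[ x ∈ oneTo n ] ∑[ u ∈ tuples n n ] (weight (suc k) u * toℕ (count x (toList u) ≡ᵇ 1)) + 0
      ≡⟨ +-identityʳ _ ⟩
    ∑[ x ∈ oneTo n ] ∑[ u ∈ tuples n n ] (weight (suc k) u * toℕ (count x (toList u) ≡ᵇ 1))
      ≡⟨ ∑-comm _ (oneTo n) (tuples n n) ⟩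
    ∑[ u ∈ tuples n n ] ∑[ x ∈ oneTo n ] (weight (suc k) u * toℕ (count x (toList u) ≡ᵇ 1))
      ≡⟨ ∑-cong (λ u → ∑-*ˡ (weight (suc k) u) _ (oneTo n)) (tuples n n) ⟩
    ∑[ u ∈ tuples n n ] (weight (suc k) u * singletons n (toList u)) ∎
    where open ≡-Reasoning

  singletons-weighted : ∑[ u ∈ tuples n n ] (weight (suc k) u * singletons n (toList u))
                        + n * ufrCount n (suc k)
                        ≡ 2 * suc k * ufrCount n (suc k)
  singletons-weighted = begin
    ∑[ u ∈ tuples n n ] (weight (suc k) u * singletons n (toList u)) + n * ufrCount n (suc k)
      ≡⟨ cong (∑[ u ∈ tuples n n ] (weight (suc k) u * singletons n (toList u)) +_)
              (sym (∑-*ˡ n (weight (suc k)) (tuples n n))) ⟩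
    ∑[ u ∈ tuples n n ] (weight (suc k) u * singletons n (toList u))
      + ∑[ u ∈ tuples n n ] (n * weight (suc k) u)
      ≡⟨ sym (∑-+ _ _ (tuples n n)) ⟩
    ∑[ u ∈ tuples n n ] (weight (suc k) u * singletons n (toList u) + n * weight (suc k) u)
      ≡⟨ ∑-allVecs-cong (oneTo-bounds n) n per-tuple ⟩
    ∑[ u ∈ tuples n n ] (2 * suc k * weight (suc k) u)
      ≡⟨ ∑-*ˡ (2 * suc k) (weight (suc k)) (tuples n n) ⟩
    2 * suc k * ufrCount n (suc k) ∎
    where
    open ≡-Reasoning
    per-tuple : ∀ u → All (InOneTo n) (toList u) →
                weight (suc k) u * singletons n (toList u) + n * weight (suc k) u ≡ 2 * suc k * weight (suc k) u
    per-tuple u bounded = begin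
      w * singletons n (toList u) + n * w ≡⟨ cong (w * singletons n (toList u) +_) (*-comm n w) ⟩
      w * singletons n (toList u) + w * n ≡⟨ sym (*-distribˡ-+ w _ n) ⟩
      w * (singletons n (toList u) + n)   ≡⟨ ufrWithDistinct-*-cong (suc k) (toList u) (λ (_ , unit) →
                                               singletons+n≡2*distinct n _ bounded (length-toList u) unit) ⟩
      w * (2 * distinct (toList u))       ≡⟨ ufrWithDistinct-distinct (suc k) (toList u) (2 *_) ⟩
      w * (2 * suc k)                     ≡⟨ *-comm w (2 * suc k) ⟩
      2 * suc k * w                       ∎
      where
      w : ℕ
      w = weight (suc k) u

-- The recurrence with its possibly negative term moved to the left-hand side.
ufrCount-recurrence : ∀ n k → ufrCount (suc n) (suc k) + n * ufrCount n (suc k)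
                              ≡ suc k * ufrCount n k + 2 * suc k * ufrCount n (suc k)
ufrCount-recurrence n k = begin
  ufrCount (suc n) (suc k) + n * ufrCount n (suc k)
    ≡⟨ cong (_+ n * ufrCount n (suc k)) ufrCount-split ⟩
  firstFresh + firstRepeated + n * ufrCount n (suc k)
    ≡⟨ +-assoc firstFresh firstRepeated _ ⟩
  firstFresh + (firstRepeated + n * ufrCount n (suc k))
    ≡⟨ cong₂ _+_ firstFresh≡
                 (trans (cong (_+ n * ufrCount n (suc k)) firstRepeated≡) singletons-weighted) ⟩
  suc k * ufrCount n k + 2 * suc k * ufrCount n (suc k) ∎
  where
  open ≡-Reasoning
  open Recurrence n k

-- Opened only here, since ℤ's prefix +_ makes ℕ sections such as (x +_) ambiguous.
open import Data.Integer as ℤ using (+_)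
open import Data.Integer.Properties using (pos-+; pos-*)
open import Data.Integer.Solver using (module +-*-Solver)

ℤ-recurrence : ∀ a b c k n → a + n * c ≡ k * b + 2 * k * c →
               + a ≡ + k ℤ.* + b ℤ.+ (+ 2 ℤ.* + k ℤ.- + suc n ℤ.+ + 1) ℤ.* + c
ℤ-recurrence a b c k n eq = begin
  + a
    ≡⟨ solve 2 (λ x y → x := x :+ y :- y) refl (+ a) (+ n ℤ.* + c) ⟩
  + a ℤ.+ + n ℤ.* + c ℤ.- + n ℤ.* + c
    ≡⟨ cong (ℤ._- + n ℤ.* + c) lifted ⟩
  + k ℤ.* + b ℤ.+ + 2 ℤ.* + k ℤ.* + c ℤ.- + n ℤ.* + c
    ≡⟨ solve 4 (λ K B C N → K :* B :+ con (+ 2) :* K :* C :- N :* C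
                          := K :* B :+ (con (+ 2) :* K :- (con (+ 1) :+ N) :+ con (+ 1)) :* C)
               refl (+ k) (+ b) (+ c) (+ n) ⟩
  + k ℤ.* + b ℤ.+ (+ 2 ℤ.* + k ℤ.- (+ 1 ℤ.+ + n) ℤ.+ + 1) ℤ.* + c
    ≡⟨ cong (λ m → + k ℤ.* + b ℤ.+ (+ 2 ℤ.* + k ℤ.- m ℤ.+ + 1) ℤ.* + c) (sym (pos-+ 1 n)) ⟩
  + k ℤ.* + b ℤ.+ (+ 2 ℤ.* + k ℤ.- + suc n ℤ.+ + 1) ℤ.* + c ∎
  where
  open ≡-Reasoning
  open +-*-Solver
  lifted : + a ℤ.+ + n ℤ.* + c ≡ + k ℤ.* + b ℤ.+ + 2 ℤ.* + k ℤ.* + c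
  lifted = begin
    + a ℤ.+ + n ℤ.* + c         ≡⟨ cong (ℤ._+_ (+ a)) (sym (pos-* n c)) ⟩
    + a ℤ.+ + (n * c)           ≡⟨ sym (pos-+ a (n * c)) ⟩
    + (a + n * c)               ≡⟨ cong +_ eq ⟩
    + (k * b + 2 * k * c)       ≡⟨ pos-+ (k * b) (2 * k * c) ⟩
    + (k * b) ℤ.+ + (2 * k * c)
      ≡⟨ cong₂ ℤ._+_ (pos-* k b) (trans (pos-* (2 * k) c) (cong (ℤ._* + c) (pos-* 2 k))) ⟩
    + k ℤ.* + b ℤ.+ + 2 ℤ.* + k ℤ.* + c ∎

theorem3p4 : (n k : ℕ) → 1 ≤ n → 1 ≤ k →
    + fUFR n k ≡
      (+ k) ℤ.* (+ fUFR (n ∸ 1) (k ∸ 1)) ℤ.+ ((+ 2) ℤ.* (+ k) ℤ.- (+ n) ℤ.+ (+ 1)) ℤ.* (+ fUFR (n ∸ 1) k)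
theorem3p4 (suc n) (suc k) _ _
  rewrite fUFR≡ufrCount (suc n) (suc k) | fUFR≡ufrCount n k | fUFR≡ufrCount n (suc k)
  = ℤ-recurrence _ (ufrCount n k) (ufrCount n (suc k)) (suc k) n (ufrCount-recurrence n k)
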